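{- Let $n$ be a positive integer, $r$ a nonnegative integer, and $\lambda$ a partition of length at most $n$ with $\lambda_1\le r$. Then $(x_1\cdots x_n)^r\,\mathrm{spo}_\lambda(x_1,\dots,x_n;z)$ is a polynomial in $x_1,\dots,x_n$ (with coefficients polynomial in $z$), and \[ \big[(x_1\cdots x_n)^r\,\mathrm{spo}_\lambda(x_1,\dots,x_n;z)\big]\big|_{x_1=0}=\begin{cases}(x_2\cdots x_n)^r\,\mathrm{spo}_{(\lambda_2,\dots,\lambda_n)}(x_2,\dots,x_n;z) & \text{if }\lambda_1=r,\\ 0 & \text{otherwise,}\end{cases} \] where $F|_{x_1=0}$ denotes substituting $x_1=0$ in $F$.
   Context: Orthosymplectic Schur functions with one $y$-variable $z$: order the alphabet $1<\bar1<\cdots<n<\bar n<1'$. A symplectic tableau of shape $\mu$ is a filling of the Young diagram of $\mu$ with entries from $\{1,\bar1,\dots,n,\bar n\}$ weakly increasing along rows, strictly increasing down columns, with all entries of row $i$ at least $i$. An orthosymplectic tableau $T$ of shape $\lambda$ is a filling of the Young diagram of $\lambda$ such that the portion with unprimed entries is a symplectic tableau and the remaining skew part (filled with $1'$) is strictly increasing along rows and weakly increasing down columns; its weight is $\prod_i x_i^{n_i(T)-n_{\bar i}(T)}z^{n_{1'}(T)}$ ($n_\alpha(T)$ = number of entries equal to $\alpha$), and $\mathrm{spo}_\lambda(x_1,\dots,x_n;z)$ is the sum of the weights. (For $n=1$, $\mathrm{spo}_{\emptyset}$ of no variables is $1$.) -}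

module Defs where

open import Data.Nat as ℕ using (ℕ; zero; suc; _≤ᵇ_; _<ᵇ_)
open import Data.Integer as ℤ using (ℤ; +_; -[1+_]; 0ℤ; 1ℤ)
open import Data.Integer.Properties as ℤP using ()
open import Data.Fin as Fin using (Fin; toℕ)
open import Data.Bool using (Bool; true; false; _∧_; if_then_else_)
open import Data.List as List using (List; []; _∷_; _++_; map; concatMap; concat; foldr; filterᵇ; allFin)
open import Data.Vec as Vec using (Vec; tabulate; replicate; zipWith; head; tail)
open import Data.Vec.Relation.Unary.All as VAll using ()
open import Data.List.Relation.Unary.All as LAll using ()
open import Data.Product using (_×_; _,_)
open import Relation.Nullary.Decidable using (⌊_⌋)

-- Alphabet 1 < 1bar < ... < n < nbar < 1'  (variables indexed 0..n-1)
data Letter (n : ℕ) : Set where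
  unb   : Fin n → Letter n
  bar   : Fin n → Letter n
  prime : Letter n

-- position in the order among unprimed letters: i ↦ 2i, i-bar ↦ 2i+1
rank : ∀ {n} → Letter n → ℕ
rank (unb j) = 2 ℕ.* toℕ j
rank (bar j) = suc (2 ℕ.* toℕ j)
rank prime   = 0   -- never used for primed letters

letters : (n : ℕ) → List (Letter n)
letters n = map unb (allFin n) ++ map bar (allFin n) ++ prime ∷ []

words : ∀ {n} → ℕ → List (List (Letter n))
words zero    = [] ∷ []
words {n} (suc k) = concatMap (λ a → map (a ∷_) (words k)) (letters n)

fillings : ∀ {n} → List ℕ → List (List (List (Letter n)))
fillings []       = [] ∷ []
fillings (l ∷ ls) = concatMap (λ w → map (w ∷_) (fillings ls)) (words l)

-- horizontally adjacent cells (a left of b):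
--  unprimed part weakly increasing in rows; unprimed part is a shape
--  (no 1' left of an unprimed entry); 1'-part strictly increasing in rows.
horizOK : ∀ {n} → Letter n → Letter n → Bool
horizOK prime   _       = false
horizOK (unb i) prime   = true
horizOK (bar i) prime   = true
horizOK (unb i) (unb j) = rank (unb i) ≤ᵇ rank (unb j)
horizOK (unb i) (bar j) = rank (unb i) ≤ᵇ rank (bar j)
horizOK (bar i) (unb j) = rank (bar i) ≤ᵇ rank (unb j)
horizOK (bar i) (bar j) = rank (bar i) ≤ᵇ rank (bar j)

-- vertically adjacent cells (a above b):
--  unprimed part strictly increasing in columns; unprimed part is a shape;
--  1'-part weakly increasing in columns.
vertOK : ∀ {n} → Letter n → Letter n → Bool
vertOK prime   prime   = true
vertOK prime   _       = false
vertOK (unb i) prime   = true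
vertOK (bar i) prime   = true
vertOK (unb i) (unb j) = rank (unb i) <ᵇ rank (unb j)
vertOK (unb i) (bar j) = rank (unb i) <ᵇ rank (bar j)
vertOK (bar i) (unb j) = rank (bar i) <ᵇ rank (unb j)
vertOK (bar i) (bar j) = rank (bar i) <ᵇ rank (bar j)

-- unprimed entries of row i (0-indexed) are ≥ the (i+1)-st unbarred letter
rowBound : ∀ {n} → ℕ → Letter n → Bool
rowBound i (unb j) = i ≤ᵇ toℕ j
rowBound i (bar j) = i ≤ᵇ toℕ j
rowBound i prime   = true

allB : ∀ {A : Set} → (A → Bool) → List A → Bool
allB p []      = true
allB p (x ∷ xs) = p x ∧ allB p xs

rowOK : ∀ {n} → List (Letter n) → Bool
rowOK []           = true
rowOK (a ∷ [])     = true
rowOK (a ∷ b ∷ w)  = horizOK a b ∧ rowOK (b ∷ w)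

colOK : ∀ {n} → List (Letter n) → List (Letter n) → Bool
colOK (a ∷ u) (b ∷ v) = vertOK a b ∧ colOK u v
colOK _       _       = true

-- validity of a filling whose first row is row i (0-indexed)
validFrom : ∀ {n} → ℕ → List (List (Letter n)) → Bool
validFrom i []             = true
validFrom i (R ∷ [])       = rowOK R ∧ allB (rowBound i) R
validFrom i (R ∷ R' ∷ Rs)  = rowOK R ∧ allB (rowBound i) R ∧ colOK R R' ∧ validFrom (suc i) (R' ∷ Rs)

tableaux : ∀ {n} → Vec ℕ n → List (List (List (Letter n)))
tableaux λ' = filterᵇ (validFrom 0) (fillings (Vec.toList λ'))

-- Laurent monomials x^e z^k, and Laurent polynomials with ℕ-coefficients
-- represented as multisets (lists) of monomials
Mono : ℕ → Set
Mono n = Vec ℤ n × ℕ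

oneMono : ∀ {n} → Mono n
oneMono = replicate _ 0ℤ , 0

mulMono : ∀ {n} → Mono n → Mono n → Mono n
mulMono (e , k) (e' , k') = zipWith ℤ._+_ e e' , k ℕ.+ k'

letterWt : ∀ {n} → Letter n → Mono n
letterWt (unb j) = tabulate (λ i → if ⌊ i Fin.≟ j ⌋ then 1ℤ else 0ℤ) , 0
letterWt (bar j) = tabulate (λ i → if ⌊ i Fin.≟ j ⌋ then ℤ.- 1ℤ else 0ℤ) , 0
letterWt prime   = replicate _ 0ℤ , 1

weight : ∀ {n} → List (List (Letter n)) → Mono n
weight T = foldr mulMono oneMono (map letterWt (concat T))

spo : ∀ {n} → Vec ℕ n → List (Mono n)
spo λ' = map weight (tableaux λ')

shift : ∀ {n} → ℕ → List (Mono n) → List (Mono n)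
shift r = map (λ { (e , k) → Vec.map (ℤ._+ (+ r)) e , k })

IsPolynomial : ∀ {n} → List (Mono n) → Set
IsPolynomial = LAll.All (λ { (e , k) → VAll.All (0ℤ ℤ.≤_) e })

-- substitution x_1 = 0 (for polynomials): monomials with positive x_1 exponent vanish
setX1Zero : ∀ {m} → List (Mono (suc m)) → List (Mono m)
setX1Zero P = map (λ { (e , k) → tail e , k })
                  (List.filter (λ { (e , k) → head e ℤ.≟ 0ℤ }) P)

-- The exponent of x_i in the weight of a tableau is #i − #ī. Column strictness bounds #ī: the
-- entries ≤ ī of a row lie below entries < ī of the row above, so by induction on the rows #ī is at
-- most the number of entries ≤ ī in the first row, hence at most λ₁ ≤ r.
-- The entries 1 and 1̄ can only occur in the first row, so the exponent r + #1 − #1̄ of x_1 vanishes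
-- only if #1̄ = r = λ₁, i.e. the first row consists of r copies of 1̄. Deleting that row and renaming
-- i ↦ i − 1 is a bijection onto the tableaux of shape (λ₂, …, λ_n) which preserves the weight in the
-- remaining variables.
module Submission where

open import Defs
open import Data.Bool using (Bool; true; false; _∧_; if_then_else_; T)
open import Data.Bool.Properties using (T-∧)
open import Data.Empty using (⊥-elim)
open import Data.Fin as Fin using (Fin; toℕ)
import Data.Fin.Properties as FinP
open import Data.Integer as ℤ using (0ℤ; _⊖_; +≤+)
import Data.Integer.Properties as ℤP
open import Data.Integer.Tactic.RingSolver using (solve-∀)
open import Data.List as List
  using (List; []; _∷_; _++_; map; concat; concatMap; filter; filterᵇ; foldr; length; allFin; replicate)
import Data.List.Properties as ListP
open import Data.List.Relation.Unary.All as All using (All; []; _∷_)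
import Data.List.Relation.Unary.All.Properties as AllP
open import Data.List.Relation.Unary.Linked using (Linked; _∷_)
open import Data.List.Relation.Binary.Permutation.Propositional using (_↭_; ↭-reflexive)
open import Data.Nat as ℕ using (ℕ; zero; suc; _+_; _*_; _≤_; _<_; _≥_; _≟_; z≤n; s≤s; _≤ᵇ_; _<ᵇ_)
import Data.Nat.Properties as ℕP
open import Algebra.Properties.CommutativeSemigroup ℕP.+-commutativeSemigroup using (interchange)
open import Data.Product using (_×_; _,_; proj₁; proj₂)
open import Data.Vec as Vec using (Vec; head; tail; toList; lookup)
import Data.Vec.Properties as VecP
import Data.Vec.Relation.Unary.All as VAll
import Data.Vec.Relation.Unary.All.Properties as VAllP
open import Function using (_∘_; _⇔_; mk⇔; Equivalence)
open import Relation.Binary.PropositionalEquality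
open import Relation.Nullary using (¬_; yes; no)
open import Relation.Nullary.Decidable using (⌊_⌋; T?)
open import Relation.Unary using (Decidable)
open import Relation.Unary.Properties using (_∩?_)

open Equivalence using (to; from)

private variable
  A B : Set
  m n : ℕ

-- words (suc k) and fillings (l ∷ ls) are conses by definition.
conses : List A → List (List A) → List (List A)
conses L W = concatMap (λ a → map (a ∷_) W) L

All-conses : {P : List A → Set} (L : List A) (W : List (List A)) →
  All (λ a → All (λ w → P (a ∷ w)) W) L → All P (conses L W)
All-conses L W h = AllP.concat⁺ (AllP.map⁺ (All.map AllP.map⁺ h))

map-conses : (f : A → B) (L : List A) (W : List (List A)) →
  map (map f) (conses L W) ≡ conses (map f L) (map (map f) W)
map-conses f [] W = refl
map-conses f (a ∷ L) W = begin
    map (map f) (map (a ∷_) W ++ conses L W)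
  ≡⟨ ListP.map-++ (map f) (map (a ∷_) W) (conses L W) ⟩
    map (map f) (map (a ∷_) W) ++ map (map f) (conses L W)
  ≡⟨ cong₂ _++_ (trans (sym (ListP.map-∘ W)) (ListP.map-∘ W)) (map-conses f L W) ⟩
    map (f a ∷_) (map (map f) W) ++ conses (map f L) (map (map f) W) ∎
  where open ≡-Reasoning

module _ {P : B → Set} (P? : Decidable P) where

  filter-map : (f : A → B) (xs : List A) → filter P? (map f xs) ≡ map f (filter (P? ∘ f) xs)
  filter-map f [] = refl
  filter-map f (x ∷ xs) with P? (f x)
  ... | yes _ = cong (f x ∷_) (filter-map f xs)
  ... | no _  = filter-map f xs

  filter-filter : {Q : B → Set} (Q? : Decidable Q) (xs : List B) →
    filter P? (filter Q? xs) ≡ filter (Q? ∩? P?) xs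
  filter-filter Q? [] = refl
  filter-filter Q? (x ∷ xs) with Q? x
  ... | no _ = filter-filter Q? xs
  ... | yes _ with P? x
  ...   | yes _ = cong (x ∷_) (filter-filter Q? xs)
  ...   | no _  = filter-filter Q? xs

module _ {P : List A → Set} (P? : Decidable P) where

  filter-conses : {Q : A → Set} (Q? : Decidable Q) {R : List A → Set} (R? : Decidable R)
    (L : List A) (W : List (List A)) → All (λ a → ∀ w → P (a ∷ w) ⇔ (Q a × R w)) L →
    filter P? (conses L W) ≡ conses (filter Q? L) (filter R? W)
  filter-conses Q? R? [] W [] = refl
  filter-conses Q? R? (a ∷ L) W (h ∷ hs) = begin
      filter P? (map (a ∷_) W ++ conses L W)
    ≡⟨ ListP.filter-++ P? (map (a ∷_) W) (conses L W) ⟩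
      filter P? (map (a ∷_) W) ++ filter P? (conses L W)
    ≡⟨ cong₂ _++_ (filter-map P? (a ∷_) W) (filter-conses Q? R? L W hs) ⟩
      map (a ∷_) (filter (P? ∘ (a ∷_)) W) ++ conses (filter Q? L) (filter R? W)
    ≡⟨ head-case ⟩
      conses (filter Q? (a ∷ L)) (filter R? W) ∎
    where
    open ≡-Reasoning
    head-case : map (a ∷_) (filter (P? ∘ (a ∷_)) W) ++ conses (filter Q? L) (filter R? W)
                      ≡ conses (filter Q? (a ∷ L)) (filter R? W)
    head-case with Q? a
    ... | yes q = cong (λ ws → map (a ∷_) ws ++ _)
                    (ListP.filter-≐ (P? ∘ (a ∷_)) R?
                       ((λ {w} p → proj₂ (to (h w) p)) , (λ {w} r → from (h w) (q , r))) W)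
    ... | no ¬q = cong (_++ _) (cong (map (a ∷_))
                    (ListP.filter-none (P? ∘ (a ∷_)) (All.universal (λ w p → ¬q (proj₁ (to (h w) p))) W)))

  filter-conses-none : (L : List A) (W : List (List A)) → All (λ a → ∀ w → ¬ P (a ∷ w)) L →
    filter P? (conses L W) ≡ []
  filter-conses-none L W h = ListP.filter-none P? (All-conses L W (All.map (λ ¬P → All.universal ¬P W) h))

T-ext : ∀ {x y} → (T x → T y) → (T y → T x) → x ≡ y
T-ext {false} {false} _ _ = refl
T-ext {false} {true}  _ g = ⊥-elim (g _)
T-ext {true}  {false} f _ = ⊥-elim (f _)
T-ext {true}  {true}  _ _ = refl

∧-proj₁ : ∀ x {y} → T (x ∧ y) → T x
∧-proj₁ x = proj₁ ∘ to (T-∧ {x})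

∧-proj₂ : ∀ x {y} → T (x ∧ y) → T y
∧-proj₂ x = proj₂ ∘ to (T-∧ {x})

allB-mono : {p q : A → Bool} → (∀ {a} → T (p a) → T (q a)) →
  (w : List A) → T (allB p w) → T (allB q w)
allB-mono h [] _ = _
allB-mono h (a ∷ w) t = from T-∧ (h (proj₁ (to T-∧ t)) , allB-mono h w (proj₂ (to T-∧ t)))

indicator : Bool → ℕ
indicator b = if b then 1 else 0

indicator-mono : ∀ {x y} → (T x → T y) → indicator x ≤ indicator y
indicator-mono {false} _ = z≤n
indicator-mono {true} {true} _ = ℕP.≤-refl
indicator-mono {true} {false} f = ⊥-elim (f _)

count : (A → Bool) → List A → ℕ
count p []      = 0
count p (a ∷ w) = indicator (p a) + count p w

count-++ : (p : A → Bool) (u v : List A) → count p (u ++ v) ≡ count p u + count p v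
count-++ p [] v = refl
count-++ p (a ∷ u) v = trans (cong (indicator (p a) +_) (count-++ p u v))
                             (sym (ℕP.+-assoc (indicator (p a)) (count p u) (count p v)))

count≤length : (p : A → Bool) (w : List A) → count p w ≤ length w
count≤length p [] = z≤n
count≤length p (a ∷ w) = ℕP.+-mono-≤ (indicator-mono {y = true} _) (count≤length p w)

count≡length⇒allB : (p : A → Bool) (w : List A) → count p w ≡ length w → T (allB p w)
count≡length⇒allB p [] _ = _
count≡length⇒allB p (a ∷ w) eq with p a
... | true  = count≡length⇒allB p w (ℕP.suc-injective eq)
... | false = ⊥-elim (ℕP.1+n≰n (subst (_≤ length w) eq (count≤length p w)))

count-+ : {p q r : A → Bool} → (∀ a → indicator (p a) + indicator (q a) ≡ indicator (r a)) →
  (w : List A) → count p w + count q w ≡ count r w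
count-+ h [] = refl
count-+ {p = p} {q} h (a ∷ w) =
  trans (interchange (indicator (p a)) (count p w) (indicator (q a)) (count q w))
        (cong₂ _+_ (h a) (count-+ h w))

count-allB-false : {p q : A → Bool} → (∀ {a} → T (q a) → p a ≡ false) →
  (w : List A) → T (allB q w) → count p w ≡ 0
count-allB-false h [] _ = refl
count-allB-false h (a ∷ w) t rewrite h (proj₁ (to T-∧ t)) = count-allB-false h w (proj₂ (to T-∧ t))

count-concat-false : {p q : A → Bool} → (∀ {a} → T (q a) → p a ≡ false) →
  (Rs : List (List A)) → T (allB (allB q) Rs) → count p (concat Rs) ≡ 0
count-concat-false h [] _ = refl
count-concat-false {p = p} h (R ∷ Rs) t = begin
    count p (R ++ concat Rs)       ≡⟨ count-++ p R (concat Rs) ⟩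
    count p R + count p (concat Rs) ≡⟨ cong₂ _+_ (count-allB-false h R (proj₁ (to T-∧ t)))
                                                  (count-concat-false h Rs (proj₂ (to T-∧ t))) ⟩
    0 ∎
  where open ≡-Reasoning

isUnb isBar : Fin n → Letter n → Bool
isUnb i (unb j) = ⌊ i Fin.≟ j ⌋
isUnb i _       = false
isBar i (bar j) = ⌊ i Fin.≟ j ⌋
isBar i _       = false

wordWeight : List (Letter n) → Mono n
wordWeight w = foldr mulMono oneMono (map letterWt w)

exponent-letterWt : (i : Fin n) (a : Letter n) →
  lookup (proj₁ (letterWt a)) i ≡ indicator (isUnb i a) ⊖ indicator (isBar i a)
exponent-letterWt i (unb j)
  rewrite VecP.lookup∘tabulate (λ k → if ⌊ k Fin.≟ j ⌋ then ℤ.1ℤ else 0ℤ) i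
  with i Fin.≟ j
... | yes _ = refl
... | no _  = refl
exponent-letterWt i (bar j)
  rewrite VecP.lookup∘tabulate (λ k → if ⌊ k Fin.≟ j ⌋ then ℤ.- ℤ.1ℤ else 0ℤ) i
  with i Fin.≟ j
... | yes _ = refl
... | no _  = refl
exponent-letterWt i prime = VecP.lookup-replicate i 0ℤ

⊖-+-⊖ : ∀ a b c d → (a ⊖ b) ℤ.+ (c ⊖ d) ≡ (a + c) ⊖ (b + d)
⊖-+-⊖ a b c d = begin
    (a ⊖ b) ℤ.+ (c ⊖ d)
  ≡⟨ cong₂ ℤ._+_ (sym (ℤP.[+m]-[+n]≡m⊖n a b)) (sym (ℤP.[+m]-[+n]≡m⊖n c d)) ⟩
    (ℤ.+ a ℤ.- ℤ.+ b) ℤ.+ (ℤ.+ c ℤ.- ℤ.+ d)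
  ≡⟨ rearrange (ℤ.+ a) (ℤ.+ b) (ℤ.+ c) (ℤ.+ d) ⟩
    (ℤ.+ a ℤ.+ ℤ.+ c) ℤ.- (ℤ.+ b ℤ.+ ℤ.+ d)
  ≡⟨ cong₂ ℤ._-_ (sym (ℤP.pos-+ a c)) (sym (ℤP.pos-+ b d)) ⟩
    ℤ.+ (a + c) ℤ.- ℤ.+ (b + d)
  ≡⟨ ℤP.[+m]-[+n]≡m⊖n (a + c) (b + d) ⟩
    (a + c) ⊖ (b + d) ∎
  where
  open ≡-Reasoning
  rearrange : ∀ x y z u → (x ℤ.- y) ℤ.+ (z ℤ.- u) ≡ (x ℤ.+ z) ℤ.- (y ℤ.+ u)
  rearrange = solve-∀

exponent-wordWeight : (i : Fin n) (w : List (Letter n)) →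
  lookup (proj₁ (wordWeight w)) i ≡ count (isUnb i) w ⊖ count (isBar i) w
exponent-wordWeight i [] = VecP.lookup-replicate i 0ℤ
exponent-wordWeight i (a ∷ w) = begin
    lookup (Vec.zipWith ℤ._+_ (proj₁ (letterWt a)) (proj₁ (wordWeight w))) i
  ≡⟨ VecP.lookup-zipWith ℤ._+_ i (proj₁ (letterWt a)) (proj₁ (wordWeight w)) ⟩
    lookup (proj₁ (letterWt a)) i ℤ.+ lookup (proj₁ (wordWeight w)) i
  ≡⟨ cong₂ ℤ._+_ (exponent-letterWt i a) (exponent-wordWeight i w) ⟩
    (indicator (isUnb i a) ⊖ indicator (isBar i a)) ℤ.+ (count (isUnb i) w ⊖ count (isBar i) w)
  ≡⟨ ⊖-+-⊖ (indicator (isUnb i a)) (indicator (isBar i a)) (count (isUnb i) w) (count (isBar i) w) ⟩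
    count (isUnb i) (a ∷ w) ⊖ count (isBar i) (a ∷ w) ∎
  where open ≡-Reasoning

-- On unprimed letters horizOK and vertOK are the order ≤ and the strict order < of the alphabet.
atMostBar belowBar : Fin n → Letter n → Bool
atMostBar i a = horizOK a (bar i)
belowBar  i a = vertOK a (bar i)

even≢odd : ∀ x y → 2 * x ≢ suc (2 * y)
even≢odd zero y ()
even≢odd (suc x) zero eq with ℕP.suc-injective (trans (sym (ℕP.*-suc 2 x)) eq)
... | ()
even≢odd (suc x) (suc y) eq =
  even≢odd x y (ℕP.suc-injective (ℕP.suc-injective
    (trans (sym (ℕP.*-suc 2 x)) (trans eq (cong suc (ℕP.*-suc 2 y))))))

≤ᵇ≡<ᵇ : ∀ {x y} → x ≢ y → (x ≤ᵇ y) ≡ (x <ᵇ y)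
≤ᵇ≡<ᵇ {x} {y} x≢y =
  T-ext (λ t → ℕP.<⇒<ᵇ (ℕP.≤∧≢⇒< (ℕP.≤ᵇ⇒≤ x y t) x≢y))
        (λ t → ℕP.≤⇒≤ᵇ (ℕP.<⇒≤ (ℕP.<ᵇ⇒< x y t)))

atMostBar-split : (i : Fin n) (a : Letter n) →
  indicator (isBar i a) + indicator (belowBar i a) ≡ indicator (atMostBar i a)
atMostBar-split i (unb j) = cong indicator (sym (≤ᵇ≡<ᵇ (even≢odd (toℕ j) (toℕ i))))
atMostBar-split i (bar j) with i Fin.≟ j
... | yes refl = trans (cong (λ b → 1 + indicator b) (T-ext (ℕP.<-irrefl refl ∘ ℕP.<ᵇ⇒< x x) ⊥-elim))
                       (cong indicator (T-ext (λ _ → ℕP.<⇒<ᵇ (ℕP.n<1+n x)) _))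
  where x = 2 * toℕ i
... | no i≢j   = cong indicator (sym (≤ᵇ≡<ᵇ
                   (i≢j ∘ sym ∘ FinP.toℕ-injective ∘ ℕP.*-cancelˡ-≡ (toℕ j) (toℕ i) 2
                        ∘ ℕP.suc-injective)))
atMostBar-split i prime = refl

<ᵇ-≤ᵇ-trans : ∀ x y z → T (x <ᵇ y) → T (y ≤ᵇ z) → T (x <ᵇ z)
<ᵇ-≤ᵇ-trans x y z s t = ℕP.<⇒<ᵇ (ℕP.<-≤-trans (ℕP.<ᵇ⇒< x y s) (ℕP.≤ᵇ⇒≤ y z t))

vertOK-atMostBar : (i : Fin n) (a b : Letter n) → T (vertOK a b) → T (atMostBar i b) → T (belowBar i a)
vertOK-atMostBar i a@(unb _) b@(unb _) = <ᵇ-≤ᵇ-trans (rank a) (rank b) (rank (bar i))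
vertOK-atMostBar i a@(unb _) b@(bar _) = <ᵇ-≤ᵇ-trans (rank a) (rank b) (rank (bar i))
vertOK-atMostBar i a@(bar _) b@(unb _) = <ᵇ-≤ᵇ-trans (rank a) (rank b) (rank (bar i))
vertOK-atMostBar i a@(bar _) b@(bar _) = <ᵇ-≤ᵇ-trans (rank a) (rank b) (rank (bar i))
vertOK-atMostBar i _       prime   _ ()
vertOK-atMostBar i prime   (unb _) ()
vertOK-atMostBar i prime   (bar _) ()

-- Counting down the rows of a tableau

count-column : (p q : Letter n → Bool) → (∀ a b → T (vertOK a b) → T (p b) → T (q a)) →
  (R R' : List (Letter n)) → T (colOK R R') → length R' ≤ length R → count p R' ≤ count q R
count-column p q h R       []       _  _         = z≤n
count-column p q h (a ∷ R) (b ∷ R') ok (s≤s len) =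
  ℕP.+-mono-≤ (indicator-mono (h a b (∧-proj₁ (vertOK a b) ok)))
              (count-column p q h R R' (∧-proj₂ (vertOK a b) ok) len)

validFrom-colOK : ∀ {k} (R R' : List (Letter n)) Rs → T (validFrom k (R ∷ R' ∷ Rs)) → T (colOK R R')
validFrom-colOK {k = k} R R' Rs t =
  ∧-proj₁ (colOK R R') (∧-proj₂ (allB (rowBound k) R) (∧-proj₂ (rowOK R) t))

validFrom-tail : ∀ {k} (R : List (Letter n)) Rs → T (validFrom k (R ∷ Rs)) → T (validFrom (suc k) Rs)
validFrom-tail R []        _ = _
validFrom-tail {k = k} R (R' ∷ Rs) t =
  ∧-proj₂ (colOK R R') (∧-proj₂ (allB (rowBound k) R) (∧-proj₂ (rowOK R) t))

count-bar≤count-atMostBar : (i : Fin n) {k : ℕ} (R : List (Letter n)) (Rs : List (List (Letter n))) →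
  Linked _≥_ (map length (R ∷ Rs)) → T (validFrom k (R ∷ Rs)) →
  count (isBar i) (concat (R ∷ Rs)) ≤ count (atMostBar i) R
count-bar≤count-atMostBar i R Rs linked valid = begin
    count (isBar i) (R ++ concat Rs)                 ≡⟨ count-++ (isBar i) R (concat Rs) ⟩
    count (isBar i) R + count (isBar i) (concat Rs)  ≤⟨ ℕP.+-monoʳ-≤ _ (lower-rows Rs linked valid) ⟩
    count (isBar i) R + count (belowBar i) R         ≡⟨ count-+ (atMostBar-split i) R ⟩
    count (atMostBar i) R                            ∎
  where
  open ℕP.≤-Reasoning
  lower-rows : ∀ {k} Rs → Linked _≥_ (map length (R ∷ Rs)) → T (validFrom k (R ∷ Rs)) →
    count (isBar i) (concat Rs) ≤ count (belowBar i) R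
  lower-rows []        _                _     = z≤n
  lower-rows (R' ∷ Rs) (R≥R' ∷ linked) valid =
    ℕP.≤-trans (count-bar≤count-atMostBar i R' Rs linked (validFrom-tail R (R' ∷ Rs) valid))
               (count-column (atMostBar i) (belowBar i) (vertOK-atMostBar i) R R'
                             (validFrom-colOK R R' Rs valid) R≥R')

words-length : (k : ℕ) → All (λ w → length w ≡ k) (words {n} k)
words-length zero = refl ∷ []
words-length {n} (suc k) =
  All-conses (letters n) (words k) (All.universal (λ _ → All.map (cong suc) (words-length k)) (letters n))

fillings-shape : (ls : List ℕ) → All (λ Rs → map length Rs ≡ ls) (fillings {n} ls)
fillings-shape [] = refl ∷ []
fillings-shape (l ∷ ls) =
  All-conses (words l) (fillings ls)
    (All.map (λ e → All.map (cong₂ _∷_ e) (fillings-shape ls)) (words-length l))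

-- Polynomiality

shiftMono : ℕ → Mono n → Mono n
shiftMono r (e , k) = Vec.map (ℤ._+ ℤ.+ r) e , k

⊖+-nonneg : ∀ u b r → b ≤ r → 0ℤ ℤ.≤ (u ⊖ b) ℤ.+ ℤ.+ r
⊖+-nonneg u b r b≤r
  rewrite ℤP.distribˡ-⊖-+-pos r u b | ℤP.⊖-≥ (ℕP.≤-trans b≤r (ℕP.m≤n+m r u)) = +≤+ z≤n

shiftMono-weight-nonneg : ∀ r (Rs : List (List (Letter n))) {l ls} → map length Rs ≡ l ∷ ls →
  Linked _≥_ (l ∷ ls) → l ≤ r → T (validFrom 0 Rs) →
  VAll.All (0ℤ ℤ.≤_) (proj₁ (shiftMono r (weight Rs)))
shiftMono-weight-nonneg r (R ∷ Rs) {l} shape linked l≤r valid =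
  VAllP.lookup⁻ λ i → subst (0ℤ ℤ.≤_) (sym (shifted-exponent i)) (⊖+-nonneg _ _ r (bars≤r i))
  where
  w = concat (R ∷ Rs)
  shifted-exponent : ∀ i →
    lookup (proj₁ (shiftMono r (weight (R ∷ Rs)))) i ≡ (count (isUnb i) w ⊖ count (isBar i) w) ℤ.+ ℤ.+ r
  shifted-exponent i = trans (VecP.lookup-map i (ℤ._+ ℤ.+ r) (proj₁ (wordWeight w)))
                             (cong (ℤ._+ ℤ.+ r) (exponent-wordWeight i w))
  bars≤r : ∀ i → count (isBar i) w ≤ r
  bars≤r i = begin
    count (isBar i) w      ≤⟨ count-bar≤count-atMostBar i R Rs (subst (Linked _≥_) (sym shape) linked) valid ⟩
    count (atMostBar i) R  ≤⟨ count≤length (atMostBar i) R ⟩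
    length R               ≡⟨ ListP.∷-injectiveˡ shape ⟩
    l                      ≤⟨ l≤r ⟩
    r                      ∎
    where open ℕP.≤-Reasoning

shift-spo-polynomial : ∀ r (λ' : Vec ℕ (suc m)) → Linked _≥_ (toList λ') → head λ' ≤ r →
  IsPolynomial (shift r (spo λ'))
shift-spo-polynomial r λ'@(l Vec.∷ ls) linked l≤r = AllP.map⁺ (AllP.map⁺ (All.zipWith (λ (f , x) → f x)
  ( AllP.filter⁺ (T? ∘ validFrom 0)
      (All.map (λ shape → shiftMono-weight-nonneg r _ shape linked l≤r) (fillings-shape (toList λ')))
  , AllP.all-filter (T? ∘ validFrom 0) (fillings (toList λ')))))

-- Renaming x_i ↦ x_{i+1}

liftLetter : Letter m → Letter (suc m)
liftLetter (unb j) = unb (Fin.suc j)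
liftLetter (bar j) = bar (Fin.suc j)
liftLetter prime   = prime

liftTableau : List (List (Letter m)) → List (List (Letter (suc m)))
liftTableau = map (map liftLetter)

rank-lift : (a : Letter m) → a ≢ prime → rank (liftLetter a) ≡ 2 + rank a
rank-lift (unb j) _ = ℕP.*-suc 2 (toℕ j)
rank-lift (bar j) _ = cong suc (ℕP.*-suc 2 (toℕ j))
rank-lift prime   p = ⊥-elim (p refl)

2+≤ᵇ2+ : ∀ x y → (2 + x ≤ᵇ 2 + y) ≡ (x ≤ᵇ y)
2+≤ᵇ2+ zero    y = refl
2+≤ᵇ2+ (suc x) y = refl

rank-lift-≤ᵇ : (a b : Letter m) → a ≢ prime → b ≢ prime →
  (rank (liftLetter a) ≤ᵇ rank (liftLetter b)) ≡ (rank a ≤ᵇ rank b)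
rank-lift-≤ᵇ a b a≢′ b≢′ =
  trans (cong₂ _≤ᵇ_ (rank-lift a a≢′) (rank-lift b b≢′)) (2+≤ᵇ2+ (rank a) (rank b))

rank-lift-<ᵇ : (a b : Letter m) → a ≢ prime → b ≢ prime →
  (rank (liftLetter a) <ᵇ rank (liftLetter b)) ≡ (rank a <ᵇ rank b)
rank-lift-<ᵇ a b a≢′ b≢′ = cong₂ _<ᵇ_ (rank-lift a a≢′) (rank-lift b b≢′)

horizOK-lift : (a b : Letter m) → horizOK (liftLetter a) (liftLetter b) ≡ horizOK a b
horizOK-lift a@(unb _) b@(unb _) = rank-lift-≤ᵇ a b (λ ()) (λ ())
horizOK-lift a@(unb _) b@(bar _) = rank-lift-≤ᵇ a b (λ ()) (λ ())
horizOK-lift a@(bar _) b@(unb _) = rank-lift-≤ᵇ a b (λ ()) (λ ())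
horizOK-lift a@(bar _) b@(bar _) = rank-lift-≤ᵇ a b (λ ()) (λ ())
horizOK-lift (unb i) prime   = refl
horizOK-lift (bar i) prime   = refl
horizOK-lift prime   b       = refl

vertOK-lift : (a b : Letter m) → vertOK (liftLetter a) (liftLetter b) ≡ vertOK a b
vertOK-lift a@(unb _) b@(unb _) = rank-lift-<ᵇ a b (λ ()) (λ ())
vertOK-lift a@(unb _) b@(bar _) = rank-lift-<ᵇ a b (λ ()) (λ ())
vertOK-lift a@(bar _) b@(unb _) = rank-lift-<ᵇ a b (λ ()) (λ ())
vertOK-lift a@(bar _) b@(bar _) = rank-lift-<ᵇ a b (λ ()) (λ ())
vertOK-lift (unb i) prime   = refl
vertOK-lift (bar i) prime   = refl
vertOK-lift prime   (unb j) = refl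
vertOK-lift prime   (bar j) = refl
vertOK-lift prime   prime   = refl

<ᵇ-suc : ∀ k j → (k <ᵇ suc j) ≡ (k ≤ᵇ j)
<ᵇ-suc zero    j = refl
<ᵇ-suc (suc k) j = refl

rowBound-lift : ∀ k (a : Letter m) → rowBound (suc k) (liftLetter a) ≡ rowBound k a
rowBound-lift k (unb j) = <ᵇ-suc k (toℕ j)
rowBound-lift k (bar j) = <ᵇ-suc k (toℕ j)
rowBound-lift k prime   = refl

rowOK-lift : (R : List (Letter m)) → rowOK (map liftLetter R) ≡ rowOK R
rowOK-lift []          = refl
rowOK-lift (a ∷ [])    = refl
rowOK-lift (a ∷ b ∷ R) = cong₂ _∧_ (horizOK-lift a b) (rowOK-lift (b ∷ R))

colOK-lift : (R R' : List (Letter m)) → colOK (map liftLetter R) (map liftLetter R') ≡ colOK R R'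
colOK-lift []      R'       = refl
colOK-lift (a ∷ R) []       = refl
colOK-lift (a ∷ R) (b ∷ R') = cong₂ _∧_ (vertOK-lift a b) (colOK-lift R R')

allB-rowBound-lift : ∀ k (R : List (Letter m)) →
  allB (rowBound (suc k)) (map liftLetter R) ≡ allB (rowBound k) R
allB-rowBound-lift k []      = refl
allB-rowBound-lift k (a ∷ R) = cong₂ _∧_ (rowBound-lift k a) (allB-rowBound-lift k R)

validFrom-lift : ∀ k (Rs : List (List (Letter m))) → validFrom (suc k) (liftTableau Rs) ≡ validFrom k Rs
validFrom-lift k []            = refl
validFrom-lift k (R ∷ [])      = cong₂ _∧_ (rowOK-lift R) (allB-rowBound-lift k R)
validFrom-lift k (R ∷ R' ∷ Rs) = cong₂ _∧_ (rowOK-lift R) (cong₂ _∧_ (allB-rowBound-lift k R)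
                                   (cong₂ _∧_ (colOK-lift R R') (validFrom-lift (suc k) (R' ∷ Rs))))

rowBound-pred : ∀ k (a : Letter n) → T (rowBound (suc k) a) → T (rowBound k a)
rowBound-pred k (unb j) t = ℕP.≤⇒≤ᵇ (ℕP.<⇒≤ (ℕP.≤ᵇ⇒≤ (suc k) (toℕ j) t))
rowBound-pred k (bar j) t = ℕP.≤⇒≤ᵇ (ℕP.<⇒≤ (ℕP.≤ᵇ⇒≤ (suc k) (toℕ j) t))
rowBound-pred k prime   t = t

validFrom⇒rowBound : ∀ k (Rs : List (List (Letter n))) → T (validFrom k Rs) → T (allB (allB (rowBound k)) Rs)
validFrom⇒rowBound k []            _ = _
validFrom⇒rowBound k (R ∷ [])      t = from T-∧ (∧-proj₂ (rowOK R) t , _)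
validFrom⇒rowBound k (R ∷ R' ∷ Rs) t = from T-∧
  ( ∧-proj₁ (allB (rowBound k) R) (∧-proj₂ (rowOK R) t)
  , allB-mono (λ {R} → allB-mono (λ {a} → rowBound-pred k a) R) (R' ∷ Rs)
      (validFrom⇒rowBound (suc k) (R' ∷ Rs) (validFrom-tail R (R' ∷ Rs) t)))

-- rowBound 1 holds exactly for the letters other than 1 and 1̄, i.e. for the renamed ones.
rowBound1-lift : (a : Letter m) → T (rowBound 1 (liftLetter a))
rowBound1-lift (unb j) = _
rowBound1-lift (bar j) = _
rowBound1-lift prime   = _

map-allFin-suc : (f : Fin (suc m) → A) → map f (allFin (suc m)) ≡ f Fin.zero ∷ map (f ∘ Fin.suc) (allFin m)
map-allFin-suc f = cong (f Fin.zero ∷_)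
  (trans (ListP.map-tabulate Fin.suc f) (sym (ListP.map-tabulate (λ i → i) (f ∘ Fin.suc))))

letters-suc : letters (suc m) ≡ unb Fin.zero ∷ map liftLetter (map unb (allFin m))
                                 ++ bar Fin.zero ∷ map liftLetter (map bar (allFin m) ++ prime ∷ [])
letters-suc {m} = cong₂ _++_
  (trans (map-allFin-suc unb) (cong (unb Fin.zero ∷_) (ListP.map-∘ (allFin m))))
  (trans (cong (_++ prime ∷ []) (map-allFin-suc bar))
         (cong (bar Fin.zero ∷_) (trans (cong (_++ prime ∷ []) (ListP.map-∘ (allFin m)))
                                        (sym (ListP.map-++ liftLetter (map bar (allFin m)) (prime ∷ []))))))

letters-rowBound1 : filterᵇ (rowBound 1) (letters (suc m)) ≡ map liftLetter (letters m)
letters-rowBound1 {m} = begin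
    filterᵇ (rowBound 1) (letters (suc m))
  ≡⟨ cong (filterᵇ (rowBound 1)) letters-suc ⟩
    filterᵇ (rowBound 1) (map liftLetter U ++ bar Fin.zero ∷ map liftLetter BP)
  ≡⟨ ListP.filter-++ (T? ∘ rowBound 1) (map liftLetter U) (bar Fin.zero ∷ map liftLetter BP) ⟩
    filterᵇ (rowBound 1) (map liftLetter U) ++ filterᵇ (rowBound 1) (map liftLetter BP)
  ≡⟨ cong₂ _++_ (lifted-kept U) (lifted-kept BP) ⟩
    map liftLetter U ++ map liftLetter BP
  ≡⟨ ListP.map-++ liftLetter U BP ⟨
    map liftLetter (letters m) ∎
  where
  open ≡-Reasoning
  U BP : List (Letter m)
  U  = map unb (allFin m)
  BP = map bar (allFin m) ++ prime ∷ []
  lifted-kept : ∀ xs → filterᵇ (rowBound 1) (map liftLetter xs) ≡ map liftLetter xs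
  lifted-kept xs = ListP.filter-all (T? ∘ rowBound 1) (AllP.map⁺ (All.universal rowBound1-lift xs))

letters-barZero : filterᵇ (isBar Fin.zero) (letters (suc m)) ≡ bar Fin.zero ∷ []
letters-barZero {m} = begin
    filterᵇ (isBar Fin.zero) (letters (suc m))
  ≡⟨ cong (filterᵇ (isBar Fin.zero)) letters-suc ⟩
    filterᵇ (isBar Fin.zero) (map liftLetter U ++ bar Fin.zero ∷ map liftLetter BP)
  ≡⟨ ListP.filter-++ (T? ∘ isBar Fin.zero) (map liftLetter U) (bar Fin.zero ∷ map liftLetter BP) ⟩
    filterᵇ (isBar Fin.zero) (map liftLetter U) ++ bar Fin.zero ∷ filterᵇ (isBar Fin.zero) (map liftLetter BP)
  ≡⟨ cong₂ (λ xs ys → xs ++ bar Fin.zero ∷ ys) (lifted-dropped U) (lifted-dropped BP) ⟩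
    bar Fin.zero ∷ [] ∎
  where
  open ≡-Reasoning
  U BP : List (Letter m)
  U  = map unb (allFin m)
  BP = map bar (allFin m) ++ prime ∷ []
  lifted-dropped : ∀ xs → filterᵇ (isBar Fin.zero) (map liftLetter xs) ≡ []
  lifted-dropped xs = ListP.filter-none (T? ∘ isBar Fin.zero)
                        (AllP.map⁺ (All.universal (λ { (unb _) () ; (bar _) () ; prime () }) xs))

filterᵇ-allB-conses : (p : A → Bool) (L : List A) (W : List (List A)) →
  filterᵇ (allB p) (conses L W) ≡ conses (filterᵇ p L) (filterᵇ (allB p) W)
filterᵇ-allB-conses p L W =
  filter-conses (T? ∘ allB p) (T? ∘ p) (T? ∘ allB p) L W (All.universal (λ _ _ → T-∧) L)

words-rowBound1 : (k : ℕ) → filterᵇ (allB (rowBound 1)) (words {suc m} k) ≡ map (map liftLetter) (words k)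
words-rowBound1 zero = refl
words-rowBound1 {m} (suc k) = begin
    filterᵇ (allB (rowBound 1)) (conses (letters (suc m)) (words k))
  ≡⟨ filterᵇ-allB-conses (rowBound 1) (letters (suc m)) (words k) ⟩
    conses (filterᵇ (rowBound 1) (letters (suc m))) (filterᵇ (allB (rowBound 1)) (words k))
  ≡⟨ cong₂ conses letters-rowBound1 (words-rowBound1 k) ⟩
    conses (map liftLetter (letters m)) (map (map liftLetter) (words k))
  ≡⟨ map-conses liftLetter (letters m) (words k) ⟨
    map (map liftLetter) (words (suc k)) ∎
  where open ≡-Reasoning

fillings-rowBound1 : (ls : List ℕ) →
  filterᵇ (allB (allB (rowBound 1))) (fillings {suc m} ls) ≡ map liftTableau (fillings ls)
fillings-rowBound1 [] = refl
fillings-rowBound1 (l ∷ ls) = begin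
    filterᵇ (allB (allB (rowBound 1))) (conses (words l) (fillings ls))
  ≡⟨ filterᵇ-allB-conses (allB (rowBound 1)) (words l) (fillings ls) ⟩
    conses (filterᵇ (allB (rowBound 1)) (words l)) (filterᵇ (allB (allB (rowBound 1))) (fillings ls))
  ≡⟨ cong₂ conses (words-rowBound1 l) (fillings-rowBound1 ls) ⟩
    conses (map (map liftLetter) (words l)) (map liftTableau (fillings ls))
  ≡⟨ map-conses (map liftLetter) (words l) (fillings ls) ⟨
    map liftTableau (fillings (l ∷ ls)) ∎
  where open ≡-Reasoning

barRow : ℕ → List (Letter (suc m))
barRow k = replicate k (bar Fin.zero)

words-barRow : (k : ℕ) → filterᵇ (allB (isBar Fin.zero)) (words {suc m} k) ≡ barRow k ∷ []
words-barRow zero    = refl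
words-barRow {m} (suc k) =
  trans (filterᵇ-allB-conses (isBar Fin.zero) (letters (suc m)) (words k))
        (cong₂ conses letters-barZero (words-barRow k))

tableaux-from-row1 : (ls : List ℕ) →
  filterᵇ (validFrom 1) (fillings {suc m} ls) ≡ map liftTableau (filterᵇ (validFrom 0) (fillings ls))
tableaux-from-row1 ls = begin
    filterᵇ (validFrom 1) (fillings ls)
  ≡⟨ ListP.filter-≐ (T? ∘ validFrom 1) (T? ∘ allB (allB (rowBound 1)) ∩? T? ∘ validFrom 1)
                    ((λ {Rs} v → validFrom⇒rowBound 1 Rs v , v) , proj₂) (fillings ls) ⟩
    filter (T? ∘ allB (allB (rowBound 1)) ∩? T? ∘ validFrom 1) (fillings ls)
  ≡⟨ filter-filter (T? ∘ validFrom 1) (T? ∘ allB (allB (rowBound 1))) (fillings ls) ⟨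
    filterᵇ (validFrom 1) (filterᵇ (allB (allB (rowBound 1))) (fillings ls))
  ≡⟨ cong (filterᵇ (validFrom 1)) (fillings-rowBound1 ls) ⟩
    filterᵇ (validFrom 1) (map liftTableau (fillings ls))
  ≡⟨ filter-map (T? ∘ validFrom 1) (map (map liftLetter)) (fillings ls) ⟩
    map liftTableau (filterᵇ (validFrom 1 ∘ map (map liftLetter)) (fillings ls))
  ≡⟨ cong (map liftTableau) (ListP.filter-≐ (T? ∘ validFrom 1 ∘ map (map liftLetter)) (T? ∘ validFrom 0)
       ((λ {Rs} → subst T (validFrom-lift 0 Rs)) , (λ {Rs} → subst T (sym (validFrom-lift 0 Rs))))
       (fillings ls)) ⟩
    map liftTableau (filterᵇ (validFrom 0) (fillings ls)) ∎
  where open ≡-Reasoning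

-- Setting x_1 = 0

dropX1 : Mono (suc m) → Mono m
dropX1 (e , k) = tail e , k

X1Free : Mono (suc m) → Set
X1Free (e , _) = head e ≡ 0ℤ

X1Free? : Decidable (X1Free {m})
X1Free? (e , _) = head e ℤ.≟ 0ℤ

Survives : ℕ → List (List (Letter (suc m))) → Set
Survives r Rs = T (validFrom 0 Rs) × X1Free (shiftMono r (weight Rs))

Survives? : ∀ r → Decidable (Survives {m} r)
Survives? r = (T? ∘ validFrom 0) ∩? (X1Free? ∘ shiftMono r ∘ weight)

setX1Zero-shift-spo : ∀ r (λ' : Vec ℕ (suc m)) →
  setX1Zero (shift r (spo λ'))
    ≡ map (dropX1 ∘ shiftMono r ∘ weight) (filter (Survives? r) (fillings (toList λ')))
setX1Zero-shift-spo r λ' = begin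
    map dropX1 (filter X1Free? (map (shiftMono r) (map weight (filterᵇ (validFrom 0) F))))
  ≡⟨ cong (map dropX1 ∘ filter X1Free?) (ListP.map-∘ (filterᵇ (validFrom 0) F)) ⟨
    map dropX1 (filter X1Free? (map (shiftMono r ∘ weight) (filterᵇ (validFrom 0) F)))
  ≡⟨ cong (map dropX1) (filter-map X1Free? (shiftMono r ∘ weight) (filterᵇ (validFrom 0) F)) ⟩
    map dropX1 (map (shiftMono r ∘ weight) (filter (X1Free? ∘ shiftMono r ∘ weight) (filterᵇ (validFrom 0) F)))
  ≡⟨ cong (map dropX1 ∘ map (shiftMono r ∘ weight))
          (filter-filter (X1Free? ∘ shiftMono r ∘ weight) (T? ∘ validFrom 0) F) ⟩
    map dropX1 (map (shiftMono r ∘ weight) (filter (Survives? r) F))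
  ≡⟨ ListP.map-∘ (filter (Survives? r) F) ⟨
    map (dropX1 ∘ shiftMono r ∘ weight) (filter (Survives? r) F) ∎
  where
  open ≡-Reasoning
  F = fillings (toList λ')

rowBound1⇒¬isUnb0 : {a : Letter (suc m)} → T (rowBound 1 a) → isUnb Fin.zero a ≡ false
rowBound1⇒¬isUnb0 {a = unb Fin.zero}    ()
rowBound1⇒¬isUnb0 {a = unb (Fin.suc _)} _ = refl
rowBound1⇒¬isUnb0 {a = bar _}           _ = refl
rowBound1⇒¬isUnb0 {a = prime}           _ = refl

rowBound1⇒¬isBar0 : {a : Letter (suc m)} → T (rowBound 1 a) → isBar Fin.zero a ≡ false
rowBound1⇒¬isBar0 {a = bar Fin.zero}    ()
rowBound1⇒¬isBar0 {a = bar (Fin.suc _)} _ = refl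
rowBound1⇒¬isBar0 {a = unb _}           _ = refl
rowBound1⇒¬isBar0 {a = prime}           _ = refl

x1-exponent : (w : List (Letter (suc m))) (Rs : List (List (Letter (suc m)))) → T (validFrom 1 Rs) →
  lookup (proj₁ (weight (w ∷ Rs))) Fin.zero ≡ count (isUnb Fin.zero) w ⊖ count (isBar Fin.zero) w
x1-exponent w Rs valid = trans (exponent-wordWeight Fin.zero (w ++ concat Rs))
  (cong₂ _⊖_ (only-first-row (isUnb Fin.zero) (λ {a} → rowBound1⇒¬isUnb0 {a = a}))
             (only-first-row (isBar Fin.zero) (λ {a} → rowBound1⇒¬isBar0 {a = a})))
  where
  only-first-row : ∀ p → (∀ {a} → T (rowBound 1 a) → p a ≡ false) →
    count p (w ++ concat Rs) ≡ count p w
  only-first-row p h = trans (count-++ p w (concat Rs))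
    (trans (cong (count p w +_) (count-concat-false h Rs (validFrom⇒rowBound 1 Rs valid))) (ℕP.+-identityʳ _))

head-shiftMono : ∀ r (x : Mono (suc m)) →
  head (proj₁ (shiftMono r x)) ≡ lookup (proj₁ x) Fin.zero ℤ.+ ℤ.+ r
head-shiftMono r ((_ Vec.∷ _) , _) = refl

⊖≡0⇒≡ : ∀ {a b} → a ⊖ b ≡ 0ℤ → a ≡ b
⊖≡0⇒≡ {a} {b} eq =
  ℤP.+-injective (ℤP.i-j≡0⇒i≡j (ℤ.+ a) (ℤ.+ b) (trans (ℤP.[+m]-[+n]≡m⊖n a b) eq))

survives⇒ : ∀ {r} (w : List (Letter (suc m))) Rs → length w ≤ r → Survives r (w ∷ Rs) →
  (T (allB (isBar Fin.zero) w) × length w ≡ r) × T (validFrom 1 Rs)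
-- #1̄ = #1 + r ≥ r ≥ length w ≥ #1̄ forces equality throughout.
survives⇒ {r = r} w Rs len≤r (valid , free) =
  (count≡length⇒allB (isBar Fin.zero) w b≡len , len≡r) , valid₁
  where
  valid₁ = validFrom-tail w Rs valid
  u = count (isUnb Fin.zero) w
  b = count (isBar Fin.zero) w
  u+r≡b : u + r ≡ b
  u+r≡b = ⊖≡0⇒≡ (begin
      (u + r) ⊖ b                                         ≡⟨ ℤP.distribˡ-⊖-+-pos r u b ⟨
      u ⊖ b ℤ.+ ℤ.+ r                                     ≡⟨ cong (ℤ._+ ℤ.+ r) (x1-exponent w Rs valid₁) ⟨
      lookup (proj₁ (weight (w ∷ Rs))) Fin.zero ℤ.+ ℤ.+ r ≡⟨ head-shiftMono r (weight (w ∷ Rs)) ⟨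
      head (proj₁ (shiftMono r (weight (w ∷ Rs))))        ≡⟨ free ⟩
      0ℤ                                                  ∎)
    where open ≡-Reasoning
  r≤b : r ≤ b
  r≤b = subst (r ≤_) u+r≡b (ℕP.m≤n+m r u)
  b≤len : b ≤ length w
  b≤len = count≤length (isBar Fin.zero) w
  len≡r : length w ≡ r
  len≡r = ℕP.≤-antisym len≤r (ℕP.≤-trans r≤b b≤len)
  b≡len : b ≡ length w
  b≡len = ℕP.≤-antisym b≤len (subst (_≤ b) (sym len≡r) r≤b)

allB-isBar0⇒barRow : (w : List (Letter (suc m))) → T (allB (isBar Fin.zero) w) → w ≡ barRow (length w)
allB-isBar0⇒barRow []                    _ = refl
allB-isBar0⇒barRow (bar Fin.zero ∷ w)    t = cong (bar Fin.zero ∷_) (allB-isBar0⇒barRow w t)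
allB-isBar0⇒barRow (unb _ ∷ _)           ()
allB-isBar0⇒barRow (bar (Fin.suc _) ∷ _) ()
allB-isBar0⇒barRow (prime ∷ _)           ()

rowOK-barRow : ∀ k → T (rowOK (barRow {m} k))
rowOK-barRow zero          = _
rowOK-barRow (suc zero)    = _
rowOK-barRow (suc (suc k)) = rowOK-barRow (suc k)

rowBound0-barRow : ∀ k → T (allB (rowBound 0) (barRow {m} k))
rowBound0-barRow zero    = _
rowBound0-barRow (suc k) = rowBound0-barRow k

bar0-vertOK : (b : Letter (suc m)) → T (rowBound 1 b) → T (vertOK (bar Fin.zero) b)
bar0-vertOK (unb Fin.zero)    ()
bar0-vertOK (unb (Fin.suc j)) _ = subst (λ x → T (1 <ᵇ x)) (sym (ℕP.*-suc 2 (toℕ j))) _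
bar0-vertOK (bar Fin.zero)    ()
bar0-vertOK (bar (Fin.suc j)) _ = _
bar0-vertOK prime             _ = _

colOK-barRow : ∀ k (R : List (Letter (suc m))) → T (allB (rowBound 1) R) → T (colOK (barRow k) R)
colOK-barRow zero    R       _ = _
colOK-barRow (suc k) []      _ = _
colOK-barRow (suc k) (b ∷ R) t =
  from T-∧ (bar0-vertOK b (∧-proj₁ (rowBound 1 b) t) , colOK-barRow k R (∧-proj₂ (rowBound 1 b) t))

validFrom0-barRow : ∀ k (Rs : List (List (Letter (suc m)))) →
  T (validFrom 1 Rs) → T (validFrom 0 (barRow k ∷ Rs))
validFrom0-barRow k []       _     = from T-∧ (rowOK-barRow k , rowBound0-barRow k)
validFrom0-barRow k (R ∷ Rs) valid = from T-∧ (rowOK-barRow k , from T-∧ (rowBound0-barRow k ,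
  from T-∧ (colOK-barRow k R (∧-proj₁ (allB (rowBound 1) R) (validFrom⇒rowBound 1 (R ∷ Rs) valid)) , valid)))

count-barRow : ∀ k → count (isUnb Fin.zero) (barRow {m} k) ≡ 0 × count (isBar Fin.zero) (barRow {m} k) ≡ k
count-barRow zero    = refl , refl
count-barRow (suc k) = proj₁ (count-barRow k) , cong suc (proj₂ (count-barRow k))

survives-barRow : ∀ r (Rs : List (List (Letter (suc m)))) → T (validFrom 1 Rs) → Survives r (barRow r ∷ Rs)
survives-barRow r Rs valid = validFrom0-barRow r Rs valid , (begin
    head (proj₁ (shiftMono r (weight (barRow r ∷ Rs))))
  ≡⟨ head-shiftMono r (weight (barRow r ∷ Rs)) ⟩
    lookup (proj₁ (weight (barRow r ∷ Rs))) Fin.zero ℤ.+ ℤ.+ r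
  ≡⟨ cong (ℤ._+ ℤ.+ r) (x1-exponent (barRow r) Rs valid) ⟩
    count (isUnb Fin.zero) (barRow r) ⊖ count (isBar Fin.zero) (barRow r) ℤ.+ ℤ.+ r
  ≡⟨ cong₂ (λ u b → u ⊖ b ℤ.+ ℤ.+ r) (proj₁ (count-barRow r)) (proj₂ (count-barRow r)) ⟩
    0 ⊖ r ℤ.+ ℤ.+ r
  ≡⟨ ℤP.distribˡ-⊖-+-pos r 0 r ⟩
    r ⊖ r
  ≡⟨ ℤP.n⊖n≡0 r ⟩
    0ℤ ∎)
  where open ≡-Reasoning

dropX1-mulMono : (x y : Mono (suc m)) → dropX1 (mulMono x y) ≡ mulMono (dropX1 x) (dropX1 y)
dropX1-mulMono ((_ Vec.∷ _) , _) ((_ Vec.∷ _) , _) = refl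

dropX1-shiftMono : ∀ r (x : Mono (suc m)) → dropX1 (shiftMono r x) ≡ shiftMono r (dropX1 x)
dropX1-shiftMono r ((_ Vec.∷ _) , _) = refl

mulMono-identityˡ : (x : Mono n) → mulMono oneMono x ≡ x
mulMono-identityˡ (e , k) = cong (_, k) (VecP.zipWith-identityˡ ℤP.+-identityˡ e)

dropX1-letterWt-bar0 : dropX1 (letterWt {suc m} (bar Fin.zero)) ≡ oneMono
dropX1-letterWt-bar0 = cong (_, 0) (trans (VecP.tabulate-allFin _) (VecP.map-const _ 0ℤ))

suc≟suc : (i j : Fin m) → ⌊ Fin.suc i Fin.≟ Fin.suc j ⌋ ≡ ⌊ i Fin.≟ j ⌋
suc≟suc i j with i Fin.≟ j
... | yes _ = refl
... | no _  = refl

dropX1-letterWt-lift : (a : Letter m) → dropX1 (letterWt (liftLetter a)) ≡ letterWt a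
dropX1-letterWt-lift (unb j) =
  cong (_, 0) (VecP.tabulate-cong (λ i → cong (if_then ℤ.1ℤ else 0ℤ) (suc≟suc i j)))
dropX1-letterWt-lift (bar j) =
  cong (_, 0) (VecP.tabulate-cong (λ i → cong (if_then ℤ.- ℤ.1ℤ else 0ℤ) (suc≟suc i j)))
dropX1-letterWt-lift prime = refl

dropX1-wordWeight-barRow : ∀ k (w : List (Letter (suc m))) →
  dropX1 (wordWeight (barRow k ++ w)) ≡ dropX1 (wordWeight w)
dropX1-wordWeight-barRow zero    w = refl
dropX1-wordWeight-barRow (suc k) w = begin
    dropX1 (mulMono (letterWt (bar Fin.zero)) (wordWeight (barRow k ++ w)))
  ≡⟨ dropX1-mulMono (letterWt (bar Fin.zero)) (wordWeight (barRow k ++ w)) ⟩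
    mulMono (dropX1 (letterWt (bar Fin.zero))) (dropX1 (wordWeight (barRow k ++ w)))
  ≡⟨ cong₂ mulMono dropX1-letterWt-bar0 (dropX1-wordWeight-barRow k w) ⟩
    mulMono oneMono (dropX1 (wordWeight w))
  ≡⟨ mulMono-identityˡ (dropX1 (wordWeight w)) ⟩
    dropX1 (wordWeight w) ∎
  where open ≡-Reasoning

dropX1-wordWeight-lift : (w : List (Letter m)) → dropX1 (wordWeight (map liftLetter w)) ≡ wordWeight w
dropX1-wordWeight-lift []      = refl
dropX1-wordWeight-lift (a ∷ w) =
  trans (dropX1-mulMono (letterWt (liftLetter a)) (wordWeight (map liftLetter w)))
        (cong₂ mulMono (dropX1-letterWt-lift a) (dropX1-wordWeight-lift w))

dropX1-weight-barRow : ∀ k (Rs : List (List (Letter m))) →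
  dropX1 (weight (barRow k ∷ liftTableau Rs)) ≡ weight Rs
dropX1-weight-barRow k Rs = begin
    dropX1 (wordWeight (barRow k ++ concat (liftTableau Rs)))
  ≡⟨ dropX1-wordWeight-barRow k (concat (liftTableau Rs)) ⟩
    dropX1 (wordWeight (concat (liftTableau Rs)))
  ≡⟨ cong (dropX1 ∘ wordWeight) (ListP.concat-map Rs) ⟩
    dropX1 (wordWeight (map liftLetter (concat Rs)))
  ≡⟨ dropX1-wordWeight-lift (concat Rs) ⟩
    weight Rs ∎
  where open ≡-Reasoning

setX1Zero-shift-spo-short : ∀ {r l} (ls : Vec ℕ m) → l < r → setX1Zero (shift r (spo (l Vec.∷ ls))) ≡ []
setX1Zero-shift-spo-short {r = r} {l} ls l<r =
  trans (setX1Zero-shift-spo r (l Vec.∷ ls))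
        (cong (map _) (filter-conses-none (Survives? r) (words l) (fillings (toList ls))
                                          (All.map no-short-survivor (words-length l))))
  where
  no-short-survivor : ∀ {w} → length w ≡ l → ∀ Rs → ¬ Survives r (w ∷ Rs)
  no-short-survivor {w} len≡l Rs s = ℕP.<-irrefl (trans (sym len≡l) len≡r) l<r
    where len≡r = proj₂ (proj₁ (survives⇒ w Rs (subst (_≤ r) (sym len≡l) (ℕP.<⇒≤ l<r)) s))

setX1Zero-shift-spo-full : ∀ r (ls : Vec ℕ m) → setX1Zero (shift r (spo (r Vec.∷ ls))) ≡ shift r (spo ls)
setX1Zero-shift-spo-full r ls = begin
    setX1Zero (shift r (spo (r Vec.∷ ls)))
  ≡⟨ setX1Zero-shift-spo r (r Vec.∷ ls) ⟩
    map g (filter (Survives? r) (conses (words r) F))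
  ≡⟨ cong (map g) (filter-conses (Survives? r) (T? ∘ allB (isBar Fin.zero)) (T? ∘ validFrom 1) (words r) F
                     (All.map first-row-criterion (words-length r))) ⟩
    map g (conses (filterᵇ (allB (isBar Fin.zero)) (words r)) (filterᵇ (validFrom 1) F))
  ≡⟨ cong₂ (λ L W → map g (conses L W)) (words-barRow r) (tableaux-from-row1 (toList ls)) ⟩
    map g (map (barRow r ∷_) (map liftTableau (tableaux ls)) ++ [])
  ≡⟨ cong (map g) (ListP.++-identityʳ _) ⟩
    map g (map (barRow r ∷_) (map liftTableau (tableaux ls)))
  ≡⟨ trans (ListP.map-∘ (tableaux ls)) (ListP.map-∘ (map liftTableau (tableaux ls))) ⟨
    map (λ Rs → g (barRow r ∷ liftTableau Rs)) (tableaux ls)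
  ≡⟨ ListP.map-cong (λ Rs → trans (dropX1-shiftMono r (weight (barRow r ∷ liftTableau Rs)))
                                  (cong (shiftMono r) (dropX1-weight-barRow r Rs))) (tableaux ls) ⟩
    map (shiftMono r ∘ weight) (tableaux ls)
  ≡⟨ ListP.map-∘ (tableaux ls) ⟩
    shift r (spo ls) ∎
  where
  open ≡-Reasoning
  g = dropX1 ∘ shiftMono r ∘ weight
  F = fillings (toList ls)
  first-row-criterion : ∀ {w} → length w ≡ r →
    ∀ Rs → Survives r (w ∷ Rs) ⇔ (T (allB (isBar Fin.zero) w) × T (validFrom 1 Rs))
  first-row-criterion {w} len≡r Rs = mk⇔
    (λ s → let ((barred , _) , valid) = survives⇒ w Rs (ℕP.≤-reflexive len≡r) s in barred , valid)
    (λ (barred , valid) → subst (λ w → Survives r (w ∷ Rs))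
       (sym (trans (allB-isBar0⇒barRow w barred) (cong barRow len≡r))) (survives-barRow r Rs valid))

lemma4p4 : (m r : ℕ) (λ' : Vec ℕ (suc m)) → Linked _≥_ (toList λ') → head λ' ≤ r →
    IsPolynomial (shift r (spo λ'))
    × (setX1Zero (shift r (spo λ'))
        ↭ (if ⌊ head λ' ≟ r ⌋ then shift r (spo (tail λ')) else []))
lemma4p4 m r λ'@(l Vec.∷ ls) linked l≤r = shift-spo-polynomial r λ' linked l≤r , ↭-reflexive x1-part
  where
  x1-part : setX1Zero (shift r (spo λ')) ≡ (if ⌊ l ≟ r ⌋ then shift r (spo ls) else [])
  x1-part with l ≟ r
  ... | yes refl = setX1Zero-shift-spo-full l ls
  ... | no l≢r   = setX1Zero-shift-spo-short ls (ℕP.≤∧≢⇒< l≤r l≢r)
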